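{- Let $A$ be a finite multiset of nonempty strings over a totally ordered alphabet, and let $w\in A$ have multiplicity $m\geq 1$ in $A$. Let $B$ be the multiset obtained from $A$ by removing one occurrence of $w$. Then (1) if $m\geq 2$, $\rho(A)=\rho(B)$; (2) if $m=1$, $0\leq\rho(A)-\rho(B)\leq 2|w|$.
   Context: For a string $x=x_1\cdots x_n$, $\texttt{runs}(x)=\sum_{i=1}^{n-1}\mathbf{1}_{x_i\neq x_{i+1}}$ (and $\texttt{runs}$ of the empty string is $0$). Every string $u$ can be written uniquely as $u=v^e$ with $v$ primitive; write $\mathrm{root}(u)=v$, $\exp(u)=e$. The $\omega$-order: $u\preceq_\omega v$ iff either $\mathrm{root}(u)=\mathrm{root}(v)$ and $\exp(u)\leq\exp(v)$, or $\mathrm{root}(u)\neq\mathrm{root}(v)$ and $u^\omega<_{\mathrm{lex}}v^\omega$. For a multiset $W=\{\!\{w_1,\dots,w_m\}\!\}$ of nonempty strings, $\texttt{ebwt}(W)$ is obtained by listing all $|w_1|+\cdots+|w_m|$ circular rotations of the $w_i$ (with multiplicity), sorting them in ascending $\omega$-order, and concatenating their last characters. $\rho(W)=\texttt{runs}(\texttt{ebwt}(W))$. -}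

module Defs where

open import Data.Nat using (ℕ; zero; suc; _+_; _*_; _<_; _%_)
open import Data.Nat.DivMod using (m%n<n)
open import Data.Fin using (Fin; fromℕ<)
open import Data.List using (List; []; _∷_; _++_; length; drop; take; map; concatMap; mapMaybe; lookup; last)
open import Data.List.Properties using (≡-dec)
open import Data.List.Relation.Unary.Linked using (Linked)
open import Data.List.Relation.Unary.All using (All)
open import Data.List.Relation.Binary.Permutation.Propositional using (_↭_)
open import Data.Product using (Σ; ∃; _×_; _,_)
open import Data.Sum using (_⊎_)
open import Data.Empty using (⊥)
open import Relation.Nullary using (¬_; yes; no)
open import Relation.Binary.PropositionalEquality using (_≡_; _≢_)
open import Relation.Binary.Structures using (IsStrictTotalOrder)

module Alphabet (Sym : Set) (_≺_ : Sym → Sym → Set)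
                (sto : IsStrictTotalOrder _≡_ _≺_) where

  open IsStrictTotalOrder sto using (_≟_)

  Str : Set
  Str = List Sym

  runs : Str → ℕ
  runs []           = 0
  runs (x ∷ [])     = 0
  runs (x ∷ y ∷ xs) = neq x y + runs (y ∷ xs)
    where
    neq : Sym → Sym → ℕ
    neq a b with a ≟ b
    ... | yes _ = 0
    ... | no  _ = 1

  pow : Str → ℕ → Str
  pow u zero    = []
  pow u (suc e) = u ++ pow u e

  Primitive : Str → Set
  Primitive v = (v ≢ []) × (∀ (u : Str) (e : ℕ) → v ≡ pow u e → e ≡ 1)

  RootExp : Str → Str → ℕ → Set
  RootExp u v e = Primitive v × (u ≡ pow v e)

  -- the infinite word u^ω as a stream (only for nonempty u = x ∷ xs)
  omega : Sym → Str → ℕ → Sym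
  omega x xs i = lookup (x ∷ xs) (fromℕ< (m%n<n i (suc (length xs))))

  _<lexω_ : (ℕ → Sym) → (ℕ → Sym) → Set
  s <lexω t = ∃ λ i → (∀ j → j < i → s j ≡ t j) × (s i ≺ t i)

  -- u^ω <_lex v^ω (false if one of them is empty; never used on empty strings)
  OmegaLess : Str → Str → Set
  OmegaLess (x ∷ xs) (y ∷ ys) = omega x xs <lexω omega y ys
  OmegaLess _        _        = ⊥

  _⪯ω_ : Str → Str → Set
  u ⪯ω v =
      (Σ Str λ r → Σ ℕ λ e → Σ ℕ λ f → RootExp u r e × RootExp v r f × e Data.Nat.≤ f)
    ⊎ (Σ Str λ r → Σ Str λ s → Σ ℕ λ e → Σ ℕ λ f →
         RootExp u r e × RootExp v s f × r ≢ s × OmegaLess u v)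

  -- the |w| circular rotations of w (with multiplicity)
  rotation : Str → ℕ → Str
  rotation w i = drop i w ++ take i w

  rotationsFrom : Str → ℕ → List Str
  rotationsFrom w zero    = []
  rotationsFrom w (suc k) = rotationsFrom w k ++ (rotation w k ∷ [])

  rotations : Str → List Str
  rotations w = rotationsFrom w (length w)

  -- all rotations of all members of a multiset (multiset = list up to permutation)
  allRotations : List Str → List Str
  allRotations W = concatMap rotations W

  IsEBWT : List Str → Str → Set
  IsEBWT W s = Σ (List Str) λ L →
    (L ↭ allRotations W) × Linked _⪯ω_ L × (s ≡ mapMaybe last L)

  HasRho : List Str → ℕ → Set
  HasRho W k = Σ Str λ s → IsEBWT W s × (runs s ≡ k)

  count : Str → List Str → ℕ
  count w []       = 0
  count w (u ∷ W) with ≡-dec _≟_ w u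
  ... | yes _ = suc (count w W)
  ... | no  _ = count w W

  Nonempty : Str → Set
  Nonempty u = u ≢ []

{-# OPTIONS --safe #-}
module Submission where

-- The ω-order is a total order on nonempty strings. The crux is uniqueness of the
-- primitive root: two periods of an infinite word give their gcd as a period
-- (Bézout), and a primitive word has no period properly dividing its length, so
-- equal ω-powers force equal primitive roots. Hence the ascending list of all
-- rotations is unique, and ebwt(A) may be computed from the sorted rotations of B
-- by inserting the |w| rotations of w one at a time. Inserting a letter into a
-- string raises its number of runs by 0, 1 or 2; when w already occurs in B, each
-- rotation can be placed next to an equal copy, which duplicates a letter and
-- leaves the runs unchanged.

open import Defs
open import Data.Nat
open import Data.Nat.Properties
open import Data.Nat.DivMod using (_%_; _/_; m≡m%n+[m/n]*n; m%n<n; [m+n]%n≡m%n; m<n⇒m%n≡m)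
open import Data.Nat.Divisibility using (_∣_; divides; ∣⇒≤; 0∣⇒≡0)
open import Data.Nat.GCD using (gcd; gcd-GCD; gcd[m,n]∣m; gcd[m,n]∣n; module Bézout)
open import Data.Nat.Induction using (<-wellFounded)
open import Induction.WellFounded using (Acc; acc)
open import Data.Fin using (fromℕ<)
open import Data.List using (List; []; _∷_; _++_; length; take; drop; lookup; concatMap; mapMaybe; last; filter)
open import Data.List.Properties
  using (length-++; ++-assoc; ++-identityʳ; ++-conicalˡ; ++-cancelˡ; length-take; mapMaybe-++; ≡-dec)
open import Data.List.Relation.Unary.All using (All; []; _∷_; universal)
open import Data.List.Relation.Unary.All.Properties using (++⁺; concat⁺; map⁺)
open import Data.List.Relation.Unary.Any using (here; there)
open import Data.List.Relation.Unary.Linked as Linked using (Linked; []; [-]; _∷_)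
import Data.List.Relation.Unary.Sorted.TotalOrder as SortedBy
open import Data.List.Relation.Unary.Sorted.TotalOrder.Properties using (↗↭↗⇒≋)
open import Data.List.Relation.Binary.Pointwise using (Pointwise-≡⇒≡)
open import Data.List.Relation.Binary.Permutation.Propositional
  using (_↭_; ↭⇒↭ₛ; ↭-refl; ↭-sym; ↭-trans; ↭-prep)
import Data.List.Relation.Binary.Permutation.Propositional as ↭
open import Data.List.Relation.Binary.Permutation.Propositional.Properties
  using (shift; shifts; ++⁺ˡ; ∈-resp-↭; All-resp-↭; ↭-length; filter-↭)
open import Data.List.Membership.Propositional using (_∈_)
open import Data.List.Membership.Propositional.Properties using (∈-∃++; ∈-++⁺ʳ; ∈-concat⁺′; ∈-map⁺)
open import Data.Maybe using (just)
open import Data.Product using (Σ; ∃; ∃₂; _×_; _,_; proj₂)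
open import Data.Sum as Sum using (_⊎_; inj₁; inj₂)
open import Function using (case_of_; _∘_; const)
open import Level using (0ℓ)
open import Relation.Nullary using (¬_; yes; no; contradiction)
open import Relation.Binary.Core using (Rel)
open import Relation.Binary.Bundles using (TotalOrder)
open import Relation.Binary.Definitions using (Total; DecidableEquality; tri<; tri≈; tri>)
open import Relation.Binary.Structures using (IsStrictTotalOrder)
open import Relation.Binary.PropositionalEquality

module Periodicity {A : Set} where

  Period : ℕ → (ℕ → A) → Set
  Period p s = ∀ i → s (i + p) ≡ s i

  period-* : ∀ {p s} → Period p s → ∀ k → Period (k * p) s
  period-* {s = s} P zero    i = cong s (+-identityʳ i)
  period-* {p} {s} P (suc k) i = begin
    s (i + (p + k * p)) ≡⟨ cong s (trans (cong (i +_) (+-comm p (k * p))) (sym (+-assoc i (k * p) p))) ⟩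
    s (i + k * p + p)   ≡⟨ P (i + k * p) ⟩
    s (i + k * p)       ≡⟨ period-* P k i ⟩
    s i                 ∎
    where open ≡-Reasoning

  period-% : ∀ {p s} .{{_ : NonZero p}} → Period p s → ∀ i → s i ≡ s (i % p)
  period-% {p} {s} P i = trans (cong s (m≡m%n+[m/n]*n i p)) (period-* P (i / p) (i % p))

  period-≗ : ∀ {p s t} .{{_ : NonZero p}} → Period p s → Period p t →
             (∀ i → i < p → s i ≡ t i) → s ≗ t
  period-≗ {p} {s} {t} P Q s≡t i = begin
    s i       ≡⟨ period-% P i ⟩
    s (i % p) ≡⟨ s≡t (i % p) (m%n<n i p) ⟩
    t (i % p) ≡⟨ period-% Q i ⟨
    t i       ∎
    where open ≡-Reasoning

  period-resp-≗ : ∀ {p s t} → s ≗ t → Period p s → Period p t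
  period-resp-≗ s≗t P i = trans (sym (s≗t _)) (trans (P i) (s≗t i))

  period-difference : ∀ {a b d s} → Period a s → Period b s → a ≡ b + d → Period d s
  period-difference {a} {b} {d} {s} Pa Pb a≡b+d i = begin
    s (i + d)     ≡⟨ Pb (i + d) ⟨
    s (i + d + b) ≡⟨ cong s (trans (+-assoc i d b) (cong (i +_) (trans (+-comm d b) (sym a≡b+d)))) ⟩
    s (i + a)     ≡⟨ Pa i ⟩
    s i           ∎
    where open ≡-Reasoning

  -- Bézout: a multiple of one period exceeds a multiple of the other by exactly gcd m n.
  period-gcd : ∀ {m n s} → Period m s → Period n s → Period (gcd m n) s
  period-gcd {m} {n} Pm Pn with Bézout.identity (gcd-GCD m n)
  ... | Bézout.+- x y eq = period-difference (period-* Pm x) (period-* Pn y) (trans (sym eq) (+-comm _ (y * n)))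
  ... | Bézout.-+ x y eq = period-difference (period-* Pn y) (period-* Pm x) (trans (sym eq) (+-comm _ (x * m)))

module Indexing {A : Set} where

  nth : A → List A → ℕ → A
  nth d []       k       = d
  nth d (x ∷ xs) zero    = x
  nth d (x ∷ xs) (suc k) = nth d xs k

  lookup-fromℕ< : ∀ d xs {k} (k<n : k < length xs) → lookup xs (fromℕ< k<n) ≡ nth d xs k
  lookup-fromℕ< d (x ∷ xs) {zero}  _         = refl
  lookup-fromℕ< d (x ∷ xs) {suc k} (s≤s k<n) = lookup-fromℕ< d xs k<n

  nth-++ˡ : ∀ d xs ys {k} → k < length xs → nth d (xs ++ ys) k ≡ nth d xs k
  nth-++ˡ d (x ∷ xs) ys {zero}  _         = refl
  nth-++ˡ d (x ∷ xs) ys {suc k} (s≤s k<n) = nth-++ˡ d xs ys k<n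

  nth-++ʳ : ∀ d xs ys k → nth d (xs ++ ys) (length xs + k) ≡ nth d ys k
  nth-++ʳ d []       ys k = refl
  nth-++ʳ d (x ∷ xs) ys k = nth-++ʳ d xs ys k

  nth-take : ∀ d xs {g k} → k < g → nth d (take g xs) k ≡ nth d xs k
  nth-take d []       {suc g} {k}     _         = refl
  nth-take d (x ∷ xs) {suc g} {zero}  _         = refl
  nth-take d (x ∷ xs) {suc g} {suc k} (s≤s k<g) = nth-take d xs k<g

  nth-ext : ∀ d (xs ys : List A) → length xs ≡ length ys →
            (∀ k → k < length xs → nth d xs k ≡ nth d ys k) → xs ≡ ys
  nth-ext d []       []       _   _  = refl
  nth-ext d (x ∷ xs) (y ∷ ys) len eq =
    cong₂ _∷_ (eq zero z<s) (nth-ext d xs ys (suc-injective len) (λ k k<n → eq (suc k) (s<s k<n)))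

  length-take-≤ : ∀ {g} {xs : List A} → g ≤ length xs → length (take g xs) ≡ g
  length-take-≤ {g} {xs} g≤|xs| = trans (length-take g xs) (m≤n⇒m⊓n≡m g≤|xs|)

  take-length-++ : ∀ (xs ys : List A) → take (length xs) (xs ++ ys) ≡ xs
  take-length-++ []       ys = refl
  take-length-++ (x ∷ xs) ys = cong (x ∷_) (take-length-++ xs ys)

  drop-nonempty : ∀ (xs : List A) {i} → i < length xs → drop i xs ≢ []
  drop-nonempty (x ∷ xs) {zero}  _         ()
  drop-nonempty (x ∷ xs) {suc i} (s≤s i<n) = drop-nonempty xs i<n

module _ {A : Set} {ℓ} {R : Rel A ℓ} where

  Linked-insert : Total R → ∀ x {xs} → Linked R xs →
                  ∃₂ λ P Q → xs ≡ P ++ Q × Linked R (P ++ x ∷ Q)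
  Linked-insert total x {[]} _ = [] , [] , refl , [-]
  Linked-insert total x {y ∷ ys} y∷ys↗ with total x y
  ... | inj₁ x≤y = [] , y ∷ ys , refl , x≤y ∷ y∷ys↗
  ... | inj₂ y≤x with Linked-insert total x (Linked.tail y∷ys↗)
  ...   | []    , Q , refl , ↗ = y ∷ [] , Q , refl , y≤x ∷ ↗
  ...   | p ∷ P , Q , refl , ↗ = y ∷ p ∷ P , Q , refl , Linked.head y∷ys↗ ∷ ↗

  Linked-duplicate : ∀ P {x Q} → R x x → Linked R (P ++ x ∷ Q) → Linked R (P ++ x ∷ x ∷ Q)
  Linked-duplicate []          x≤x ↗         = x≤x ∷ ↗
  Linked-duplicate (p ∷ [])    x≤x (p≤x ∷ ↗) = p≤x ∷ x≤x ∷ ↗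
  Linked-duplicate (p ∷ q ∷ P) x≤x (p≤q ∷ ↗) = p≤q ∷ Linked-duplicate (q ∷ P) x≤x ↗

concatMap-↭ : ∀ {A B : Set} (f : A → List B) {xs ys} → xs ↭ ys → concatMap f xs ↭ concatMap f ys
concatMap-↭ f ↭.refl           = ↭-refl
concatMap-↭ f (↭.prep x p)     = ++⁺ˡ (f x) (concatMap-↭ f p)
concatMap-↭ f (↭.swap x y p)   = ↭-trans (shifts (f x) (f y)) (++⁺ˡ (f y) (++⁺ˡ (f x) (concatMap-↭ f p)))
concatMap-↭ f (↭.trans p q)    = ↭-trans (concatMap-↭ f p) (concatMap-↭ f q)

module EBWT (Sym : Set) (_≺_ : Sym → Sym → Set) (sto : IsStrictTotalOrder _≡_ _≺_) where

  open Alphabet Sym _≺_ sto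
  open IsStrictTotalOrder sto using ()
    renaming (compare to ≺-compare; _≟_ to _≟ₛ_; irrefl to ≺-irrefl; trans to ≺-trans)
  open Periodicity
  open Indexing

  _≟*_ : DecidableEquality Str
  _≟*_ = ≡-dec _≟ₛ_

  -- Primitive roots

  length-pow : ∀ r e → length (pow r e) ≡ e * length r
  length-pow r zero    = refl
  length-pow r (suc e) = trans (length-++ r) (cong (length r +_) (length-pow r e))

  pow-+ : ∀ r a b → pow r a ++ pow r b ≡ pow r (a + b)
  pow-+ r zero    b = refl
  pow-+ r (suc a) b = trans (++-assoc r (pow r a) (pow r b)) (cong (r ++_) (pow-+ r a b))

  pow-* : ∀ r a b → pow (pow r a) b ≡ pow r (b * a)
  pow-* r a zero    = refl
  pow-* r a (suc b) = trans (cong (pow r a ++_) (pow-* r a b)) (pow-+ r a (b * a))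

  pow-[] : ∀ e → pow [] e ≡ []
  pow-[] zero    = refl
  pow-[] (suc e) = pow-[] e

  pow-injectiveʳ : ∀ {r} → r ≢ [] → ∀ e f → pow r e ≡ pow r f → e ≡ f
  pow-injectiveʳ r≢[] zero    zero    _  = refl
  pow-injectiveʳ r≢[] zero    (suc f) eq = contradiction (++-conicalˡ _ _ (sym eq)) r≢[]
  pow-injectiveʳ r≢[] (suc e) zero    eq = contradiction (++-conicalˡ _ _ eq) r≢[]
  pow-injectiveʳ r≢[] (suc e) (suc f) eq = cong suc (pow-injectiveʳ r≢[] e f (++-cancelˡ _ _ _ eq))

  omega-nth-% : ∀ d x xs i → omega x xs i ≡ nth d (x ∷ xs) (i % suc (length xs))
  omega-nth-% d x xs i = lookup-fromℕ< d (x ∷ xs) (m%n<n i (suc (length xs)))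

  omega-nth : ∀ d x xs {i} → i < suc (length xs) → omega x xs i ≡ nth d (x ∷ xs) i
  omega-nth d x xs {i} i<n = trans (omega-nth-% d x xs i) (cong (nth d (x ∷ xs)) (m<n⇒m%n≡m i<n))

  omega-period : ∀ x xs → Period (suc (length xs)) (omega x xs)
  omega-period x xs i = begin
    omega x xs (i + n)            ≡⟨ omega-nth-% x x xs (i + n) ⟩
    nth x (x ∷ xs) ((i + n) % n)  ≡⟨ cong (nth x (x ∷ xs)) ([m+n]%n≡m%n i n) ⟩
    nth x (x ∷ xs) (i % n)        ≡⟨ omega-nth-% x x xs i ⟨
    omega x xs i                  ∎
    where open ≡-Reasoning
          n = suc (length xs)

  nth-pow : ∀ d y ys e {k} → k < e * suc (length ys) → nth d (pow (y ∷ ys) e) k ≡ omega y ys k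
  nth-pow d y ys (suc e) {k} k<n with k <? suc (length ys)
  ... | yes k<|y| = trans (nth-++ˡ d (y ∷ ys) _ k<|y|) (sym (omega-nth d y ys k<|y|))
  ... | no  k≮|y| with m≤n⇒∃[o]m+o≡n (≮⇒≥ k≮|y|)
  ...   | k′ , refl = begin
    nth d (pow (y ∷ ys) (suc e)) (|y| + k′) ≡⟨ nth-++ʳ d (y ∷ ys) _ k′ ⟩
    nth d (pow (y ∷ ys) e) k′               ≡⟨ nth-pow d y ys e (+-cancelˡ-< |y| k′ _ k<n) ⟩
    omega y ys k′                           ≡⟨ omega-period y ys k′ ⟨
    omega y ys (k′ + |y|)                   ≡⟨ cong (omega y ys) (+-comm k′ |y|) ⟩
    omega y ys (|y| + k′)                   ∎
    where open ≡-Reasoning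
          |y| = suc (length ys)

  omega-pow : ∀ {x xs y ys} e → x ∷ xs ≡ pow (y ∷ ys) e → omega x xs ≗ omega y ys
  omega-pow {x} {xs} {y} {ys} e eq = period-≗ (omega-period x xs) period-y agree
    where
    n≡e*m : suc (length xs) ≡ e * suc (length ys)
    n≡e*m = trans (cong length eq) (length-pow (y ∷ ys) e)
    period-y : Period (suc (length xs)) (omega y ys)
    period-y = subst (λ p → Period p (omega y ys)) (sym n≡e*m) (period-* (omega-period y ys) e)
    agree : ∀ i → i < suc (length xs) → omega x xs i ≡ omega y ys i
    agree i i<n = trans (omega-nth x x xs i<n)
      (trans (cong (λ u → nth x u i) eq) (nth-pow x y ys e (subst (i <_) n≡e*m i<n)))

  omega-≗⇒≡ : ∀ {x xs y ys} → length xs ≡ length ys → omega x xs ≗ omega y ys → x ∷ xs ≡ y ∷ ys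
  omega-≗⇒≡ {x} {xs} {y} {ys} |xs|≡|ys| x≗y = nth-ext x (x ∷ xs) (y ∷ ys) (cong suc |xs|≡|ys|) λ k k<n →
    trans (sym (omega-nth x x xs k<n)) (trans (x≗y k) (omega-nth x y ys (subst (k <_) (cong suc |xs|≡|ys|) k<n)))

  period⇒omega-take : ∀ {y ys g} → g ≤ length ys → Period (suc g) (omega y ys) →
                      omega y ys ≗ omega y (take g ys)
  period⇒omega-take {y} {ys} {g} g≤|ys| P = period-≗ P period-take agree
    where
    |take|≡g : length (take g ys) ≡ g
    |take|≡g = length-take-≤ g≤|ys|
    period-take : Period (suc g) (omega y (take g ys))
    period-take = subst (λ p → Period (suc p) (omega y (take g ys))) |take|≡g (omega-period y (take g ys))
    agree : ∀ i → i < suc g → omega y ys i ≡ omega y (take g ys) i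
    agree i i<g = begin
      omega y ys i                 ≡⟨ omega-nth y y ys (≤-trans i<g (s≤s g≤|ys|)) ⟩
      nth y (y ∷ ys) i             ≡⟨ nth-take y (y ∷ ys) i<g ⟨
      nth y (y ∷ take g ys) i      ≡⟨ omega-nth y y (take g ys) (subst (λ p → i < suc p) (sym |take|≡g) i<g) ⟨
      omega y (take g ys) i        ∎
      where open ≡-Reasoning

  -- A period g dividing |v| exhibits v as (v₁ ⋯ v_g) ^ (|v| / g).
  primitive-period : ∀ {y ys g} → Primitive (y ∷ ys) → Period (suc g) (omega y ys) →
                     suc g ∣ suc (length ys) → suc g ≡ suc (length ys)
  primitive-period {y} {ys} {g} (_ , prim) P g∣n@(divides q n≡q*g) = begin
    suc g           ≡⟨ *-identityˡ (suc g) ⟨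
    1 * suc g       ≡⟨ cong (_* suc g) (prim (y ∷ take g ys) q v≡xᵠ) ⟨
    q * suc g       ≡⟨ n≡q*g ⟨
    suc (length ys) ∎
    where
    open ≡-Reasoning
    g≤|ys| : g ≤ length ys
    g≤|ys| = s≤s⁻¹ (∣⇒≤ g∣n)
    |xᵠ|≡n : length (pow (y ∷ take g ys) q) ≡ suc (length ys)
    |xᵠ|≡n = trans (length-pow _ q) (trans (cong (λ p → q * suc p) (length-take-≤ g≤|ys|)) (sym n≡q*g))
    v≡xᵠ : y ∷ ys ≡ pow (y ∷ take g ys) q
    v≡xᵠ = nth-ext y _ _ (sym |xᵠ|≡n) λ k k<n →
      trans (sym (omega-nth y y ys k<n)) (trans (period⇒omega-take g≤|ys| P k)
        (sym (nth-pow y y (take g ys) q (subst (k <_) (trans (sym |xᵠ|≡n) (length-pow _ q)) k<n))))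

  primitive-omega-injective : ∀ {y ys z zs} → Primitive (y ∷ ys) → Primitive (z ∷ zs) →
                              omega y ys ≗ omega z zs → y ∷ ys ≡ z ∷ zs
  primitive-omega-injective {y} {ys} {z} {zs} py pz y≗z = omega-≗⇒≡ (common-period (gcd n m)
    (gcd[m,n]∣m n m) (gcd[m,n]∣n n m) (period-gcd (omega-period y ys) period-m)) y≗z
    where
    n = suc (length ys)
    m = suc (length zs)
    period-m : Period m (omega y ys)
    period-m = period-resp-≗ (λ i → sym (y≗z i)) (omega-period z zs)
    common-period : ∀ g → g ∣ n → g ∣ m → Period g (omega y ys) → length ys ≡ length zs
    common-period zero    0∣n _   _ = contradiction (0∣⇒≡0 0∣n) λ ()
    common-period (suc g) g∣n g∣m P = suc-injective
      (trans (sym (primitive-period py P g∣n)) (primitive-period pz (period-resp-≗ y≗z P) g∣m))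

  primitive⊎properPower : ∀ u → u ≢ [] →
    Primitive u ⊎ (Σ Str λ y → Σ ℕ λ e → length y < length u × u ≡ pow y (2 + e))
  -- A factorisation u = y ^ (2 + e) has |y| < |u| and e < |u|, so a bounded search finds one.
  primitive⊎properPower u u≢[]
    with anyUpTo? (λ d → anyUpTo? (λ e → u ≟* pow (take d u) (2 + e)) (length u)) (length u)
  ... | yes (d , d<|u| , e , _ , u≡) =
    inj₂ (take d u , e , subst (_< length u) (sym (length-take-≤ (<⇒≤ d<|u|))) d<|u| , u≡)
  ... | no ∄ = inj₁ (u≢[] , prim)
    where
    prim : ∀ y e → u ≡ pow y e → e ≡ 1
    prim y            zero          u≡ = contradiction u≡ u≢[]
    prim y            (suc zero)    _  = refl
    prim []           (suc (suc e)) u≡ = contradiction (trans u≡ (pow-[] (2 + e))) u≢[]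
    prim y@(_ ∷ _)    (suc (suc e)) u≡ = contradiction (length y , |y|<|u| , e , e<|u| , u≡take) ∄
      where
      |u|≡ : length u ≡ (2 + e) * length y
      |u|≡ = trans (cong length u≡) (length-pow y (2 + e))
      |y|<|u| : length y < length u
      |y|<|u| = subst (length y <_) (sym |u|≡) (m<m+n (length y) z<s)
      e<|u| : e < length u
      e<|u| = subst (e <_) (sym |u|≡) (≤-trans (n≤1+n (1 + e)) (m≤m*n (2 + e) (length y)))
      u≡take : u ≡ pow (take (length y) u) (2 + e)
      u≡take = trans u≡ (cong (λ t → pow t (2 + e)) (sym (trans (cong (take (length y)) u≡) (take-length-++ y _))))

  root : ∀ u → u ≢ [] → Σ Str λ r → Σ ℕ λ e → RootExp u r e
  root u = go u (<-wellFounded (length u))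
    where
    go : ∀ u → Acc _<_ (length u) → u ≢ [] → Σ Str λ r → Σ ℕ λ e → RootExp u r e
    go u (acc shorter) u≢[] with primitive⊎properPower u u≢[]
    ... | inj₁ prim = u , 1 , prim , sym (++-identityʳ u)
    ... | inj₂ (y , e , |y|<|u| , refl) with go y (shorter |y|<|u|) (λ { refl → u≢[] (pow-[] (2 + e)) })
    ...   | r , f , prim , refl = r , (2 + e) * f , prim , pow-* r f (2 + e)

  sameRoot⇒≗ : ∀ {x xs y ys r} e f → RootExp (x ∷ xs) r e → RootExp (y ∷ ys) r f →
               omega x xs ≗ omega y ys
  sameRoot⇒≗ {r = []}    _ _ ((r≢[] , _) , _) _ = contradiction refl r≢[]
  sameRoot⇒≗ {r = _ ∷ _} e f (_ , u≡) (_ , v≡) i = trans (omega-pow e u≡ i) (sym (omega-pow f v≡ i))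

  ≗⇒sameRoot : ∀ {x xs y ys r s} e f → RootExp (x ∷ xs) r e → RootExp (y ∷ ys) s f →
               omega x xs ≗ omega y ys → r ≡ s
  ≗⇒sameRoot {r = []}            _ _ ((r≢[] , _) , _) _ _ = contradiction refl r≢[]
  ≗⇒sameRoot {r = _ ∷ _} {[]}    _ _ _ ((s≢[] , _) , _) _ = contradiction refl s≢[]
  ≗⇒sameRoot {r = _ ∷ _} {_ ∷ _} e f (pr , u≡) (ps , v≡) u≗v =
    primitive-omega-injective pr ps λ i → trans (sym (omega-pow e u≡ i)) (trans (u≗v i) (omega-pow f v≡ i))

  RootExp-unique : ∀ {x xs r s} e f → RootExp (x ∷ xs) r e → RootExp (x ∷ xs) s f → r ≡ s × e ≡ f
  RootExp-unique e f Ru@((r≢[] , _) , u≡) Rv@(_ , u≡′) with ≗⇒sameRoot e f Ru Rv (λ _ → refl)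
  ... | refl = refl , pow-injectiveʳ r≢[] e f (trans (sym u≡) u≡′)

  -- The ω-order

  <lexω-respˡ-≗ : ∀ {s s′ t} → s ≗ s′ → s <lexω t → s′ <lexω t
  <lexω-respˡ-≗ s≗s′ (i , agree , sᵢ≺tᵢ) =
    i , (λ j j<i → trans (sym (s≗s′ j)) (agree j j<i)) , subst (_≺ _) (s≗s′ i) sᵢ≺tᵢ

  <lexω-respʳ-≗ : ∀ {s t t′} → t ≗ t′ → s <lexω t → s <lexω t′
  <lexω-respʳ-≗ t≗t′ (i , agree , sᵢ≺tᵢ) =
    i , (λ j j<i → trans (agree j j<i) (t≗t′ j)) , subst (_ ≺_) (t≗t′ i) sᵢ≺tᵢ

  <lexω-irrefl : ∀ {s t} → s ≗ t → ¬ (s <lexω t)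
  <lexω-irrefl s≗t (i , _ , sᵢ≺tᵢ) = ≺-irrefl (s≗t i) sᵢ≺tᵢ

  <lexω-trans : ∀ {s t u} → s <lexω t → t <lexω u → s <lexω u
  <lexω-trans {s} {t} {u} (i , s≡t , sᵢ≺tᵢ) (j , t≡u , tⱼ≺uⱼ) with <-cmp i j
  ... | tri< i<j _ _ =
    i , (λ k k<i → trans (s≡t k k<i) (t≡u k (<-trans k<i i<j))) , subst (s i ≺_) (t≡u i i<j) sᵢ≺tᵢ
  ... | tri≈ _ refl _ =
    i , (λ k k<i → trans (s≡t k k<i) (t≡u k k<i)) , ≺-trans sᵢ≺tᵢ tⱼ≺uⱼ
  ... | tri> _ _ j<i =
    j , (λ k k<j → trans (s≡t k (<-trans k<j j<i)) (t≡u k k<j)) , subst (_≺ u j) (sym (s≡t j j<i)) tⱼ≺uⱼ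

  <lexω-compare : ∀ s t N → (∀ i → i < N → s i ≡ t i) ⊎ s <lexω t ⊎ t <lexω s
  <lexω-compare s t zero = inj₁ λ _ ()
  <lexω-compare s t (suc N) with <lexω-compare s t N
  ... | inj₂ s≶t = inj₂ s≶t
  ... | inj₁ agree with ≺-compare (s N) (t N)
  ...   | tri< sₙ≺tₙ _ _ = inj₂ (inj₁ (N , agree , sₙ≺tₙ))
  ...   | tri> _ _ tₙ≺sₙ = inj₂ (inj₂ (N , (λ i i<N → sym (agree i i<N)) , tₙ≺sₙ))
  ...   | tri≈ _ sₙ≡tₙ _ = inj₁ λ i i<1+N → case m≤n⇒m<n∨m≡n (s≤s⁻¹ i<1+N) of λ where
            (inj₁ i<N)  → agree i i<N
            (inj₂ refl) → sₙ≡tₙ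

  ⪯ω-refl : ∀ x xs → (x ∷ xs) ⪯ω (x ∷ xs)
  ⪯ω-refl x xs with root (x ∷ xs) (λ ())
  ... | r , e , R = inj₁ (r , e , e , R , R , ≤-refl)

  ⪯ω-trans : ∀ {x xs y ys z zs} →
             (x ∷ xs) ⪯ω (y ∷ ys) → (y ∷ ys) ⪯ω (z ∷ zs) → (x ∷ xs) ⪯ω (z ∷ zs)
  ⪯ω-trans (inj₁ (r , e , f , Ru , Rv , e≤f)) (inj₁ (_ , f′ , g , Rv′ , Rw , f′≤g))
    with RootExp-unique f f′ Rv Rv′
  ... | refl , refl = inj₁ (r , e , g , Ru , Rw , ≤-trans e≤f f′≤g)
  ⪯ω-trans (inj₁ (r , e , f , Ru , Rv , _)) (inj₂ (_ , t , f′ , g , Rv′ , Rw , r≢t , v<w))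
    with RootExp-unique f f′ Rv Rv′
  ... | refl , refl = inj₂ (r , t , e , g , Ru , Rw , r≢t , <lexω-respˡ-≗ (sameRoot⇒≗ f e Rv Ru) v<w)
  ⪯ω-trans (inj₂ (r , s , e , f , Ru , Rv , r≢s , u<v)) (inj₁ (_ , f′ , g , Rv′ , Rw , _))
    with RootExp-unique f f′ Rv Rv′
  ... | refl , refl = inj₂ (r , s , e , g , Ru , Rw , r≢s , <lexω-respʳ-≗ (sameRoot⇒≗ f g Rv Rw) u<v)
  ⪯ω-trans (inj₂ (r , _ , e , _ , Ru , _ , _ , u<v)) (inj₂ (_ , t , _ , g , _ , Rw , _ , v<w)) =
    inj₂ (r , t , e , g , Ru , Rw , r≢t , u<w)
    where
    u<w = <lexω-trans u<v v<w
    r≢t : r ≢ t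
    r≢t refl = <lexω-irrefl (sameRoot⇒≗ e g Ru Rw) u<w

  ⪯ω-antisym : ∀ {x xs y ys} → (x ∷ xs) ⪯ω (y ∷ ys) → (y ∷ ys) ⪯ω (x ∷ xs) → x ∷ xs ≡ y ∷ ys
  ⪯ω-antisym (inj₁ (r , e , f , Ru , Rv , e≤f)) (inj₁ (_ , f′ , e′ , Rv′ , Ru′ , f′≤e′))
    with RootExp-unique e e′ Ru Ru′ | RootExp-unique f f′ Rv Rv′
  ... | refl , refl | _ , refl = trans (proj₂ Ru) (trans (cong (pow r) (≤-antisym e≤f f′≤e′)) (sym (proj₂ Rv)))
  ⪯ω-antisym (inj₁ (_ , e , f , Ru , Rv , _)) (inj₂ (_ , _ , _ , _ , _ , _ , _ , v<u)) =
    contradiction v<u (<lexω-irrefl (sameRoot⇒≗ f e Rv Ru))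
  ⪯ω-antisym (inj₂ (_ , _ , _ , _ , _ , _ , _ , u<v)) (inj₁ (_ , f , e , Rv , Ru , _)) =
    contradiction u<v (<lexω-irrefl (sameRoot⇒≗ e f Ru Rv))
  ⪯ω-antisym (inj₂ (_ , _ , _ , _ , _ , _ , _ , u<v)) (inj₂ (_ , _ , _ , _ , _ , _ , _ , v<u)) =
    contradiction (<lexω-trans u<v v<u) (<lexω-irrefl λ _ → refl)

  ⪯ω-total : ∀ x xs y ys → (x ∷ xs) ⪯ω (y ∷ ys) ⊎ (y ∷ ys) ⪯ω (x ∷ xs)
  ⪯ω-total x xs y ys with root (x ∷ xs) (λ ()) | root (y ∷ ys) (λ ())
  ... | r , e , Ru | s , f , Rv with r ≟* s
  ...   | yes refl =
    Sum.map (λ e≤f → inj₁ (r , e , f , Ru , Rv , e≤f)) (λ f≤e → inj₁ (r , f , e , Rv , Ru , f≤e)) (≤-total e f)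
  ...   | no r≢s with <lexω-compare (omega x xs) (omega y ys) (suc (length xs) * suc (length ys))
  ...     | inj₂ (inj₁ u<v) = inj₁ (inj₂ (r , s , e , f , Ru , Rv , r≢s , u<v))
  ...     | inj₂ (inj₂ v<u) = inj₂ (inj₂ (s , r , f , e , Rv , Ru , r≢s ∘ sym , v<u))
  ...     | inj₁ agree = contradiction (≗⇒sameRoot e f Ru Rv (period-≗ period-u period-v agree)) r≢s
    where
    n = suc (length xs)
    m = suc (length ys)
    period-u : Period (n * m) (omega x xs)
    period-u = subst (λ p → Period p (omega x xs)) (*-comm m n) (period-* (omega-period x xs) m)
    period-v : Period (n * m) (omega y ys)
    period-v = period-* (omega-period y ys) n

  ⪯ω-[] : ∀ {x xs} → ¬ ((x ∷ xs) ⪯ω [])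
  ⪯ω-[] (inj₁ (r , e , f , ((r≢[] , _) , u≡) , (_ , []≡) , e≤f)) with pow-injectiveʳ r≢[] 0 f []≡
  ... | refl with n≤0⇒n≡0 e≤f
  ...   | refl = case u≡ of λ ()

  -- ⪯ω is reflexive at [] only if some primitive string exists. Putting [] below
  -- everything gives a total order on all of Str, to which the library's theory of
  -- sorted lists applies.
  _≤ω_ : Str → Str → Set
  u ≤ω v = Nonempty u → u ⪯ω v

  ≤ω-reflexive : ∀ {u v} → u ≡ v → u ≤ω v
  ≤ω-reflexive {[]}     refl []≢[] = contradiction refl []≢[]
  ≤ω-reflexive {x ∷ xs} refl _     = ⪯ω-refl x xs

  ≤ω-trans : ∀ {u v w} → u ≤ω v → v ≤ω w → u ≤ω w
  ≤ω-trans {[]}                    _   _   []≢[] = contradiction refl []≢[]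
  ≤ω-trans {_ ∷ _} {[]}            u≤v _   _     = contradiction (u≤v λ ()) ⪯ω-[]
  ≤ω-trans {_ ∷ _} {_ ∷ _} {[]}    _   v≤w _     = contradiction (v≤w λ ()) ⪯ω-[]
  ≤ω-trans {_ ∷ _} {_ ∷ _} {_ ∷ _} u≤v v≤w _     = ⪯ω-trans (u≤v λ ()) (v≤w λ ())

  ≤ω-antisym : ∀ {u v} → u ≤ω v → v ≤ω u → u ≡ v
  ≤ω-antisym {[]}    {[]}    _   _   = refl
  ≤ω-antisym {[]}    {_ ∷ _} _   v≤u = contradiction (v≤u λ ()) ⪯ω-[]
  ≤ω-antisym {_ ∷ _} {[]}    u≤v _   = contradiction (u≤v λ ()) ⪯ω-[]
  ≤ω-antisym {_ ∷ _} {_ ∷ _} u≤v v≤u = ⪯ω-antisym (u≤v λ ()) (v≤u λ ())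

  ≤ω-total : Total _≤ω_
  ≤ω-total []       _        = inj₁ λ []≢[] → contradiction refl []≢[]
  ≤ω-total (_ ∷ _)  []       = inj₂ λ []≢[] → contradiction refl []≢[]
  ≤ω-total (x ∷ xs) (y ∷ ys) = Sum.map const const (⪯ω-total x xs y ys)

  ≤ω-totalOrder : TotalOrder 0ℓ 0ℓ 0ℓ
  ≤ω-totalOrder = record
    { isTotalOrder = record
      { isPartialOrder = record
        { isPreorder = record { isEquivalence = isEquivalence ; reflexive = ≤ω-reflexive ; trans = ≤ω-trans }
        ; antisym    = ≤ω-antisym
        }
      ; total = ≤ω-total
      }
    }

  open SortedBy ≤ω-totalOrder using (Sorted)

  Sorted-unique : ∀ {L L′} → Sorted L → Sorted L′ → L ↭ L′ → L ≡ L′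
  Sorted-unique L↗ L′↗ L↭L′ = Pointwise-≡⇒≡ (↗↭↗⇒≋ ≤ω-totalOrder L↗ L′↗ (↭⇒↭ₛ L↭L′))

  ⪯ω-Sorted : ∀ {L} → Linked _⪯ω_ L → Sorted L
  ⪯ω-Sorted = Linked.map const

  Sorted-⪯ω : ∀ {L} → All Nonempty L → Sorted L → Linked _⪯ω_ L
  Sorted-⪯ω _                []          = []
  Sorted-⪯ω _                [-]         = [-]
  Sorted-⪯ω (u≢[] ∷ L-nonempty) (u≤v ∷ L↗) = u≤v u≢[] ∷ Sorted-⪯ω L-nonempty L↗

  -- Runs

  mismatch : Sym → Sym → ℕ
  mismatch a b with a ≟ₛ b
  ... | yes _ = 0
  ... | no  _ = 1

  headMismatch : Sym → Str → ℕ
  headMismatch a []      = 0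
  headMismatch a (b ∷ _) = mismatch a b

  runs-∷ : ∀ a t → runs (a ∷ t) ≡ headMismatch a t + runs t
  runs-∷ a []      = refl
  runs-∷ a (b ∷ t) with a ≟ₛ b
  ... | yes _ = refl
  ... | no  _ = refl

  mismatch≤1 : ∀ a b → mismatch a b ≤ 1
  mismatch≤1 a b with a ≟ₛ b
  ... | yes _ = z≤n
  ... | no  _ = ≤-refl

  mismatch-refl : ∀ a → mismatch a a ≡ 0
  mismatch-refl a with a ≟ₛ a
  ... | yes _   = refl
  ... | no  a≢a = contradiction refl a≢a

  headMismatch≤1 : ∀ a t → headMismatch a t ≤ 1
  headMismatch≤1 a []      = z≤n
  headMismatch≤1 a (b ∷ _) = mismatch≤1 a b

  headMismatch-triangle : ∀ a c t → headMismatch a t ≤ mismatch a c + headMismatch c t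
  headMismatch-triangle a c []      = z≤n
  headMismatch-triangle a c (b ∷ _) with a ≟ₛ c
  ... | yes refl = ≤-refl
  ... | no  _    = ≤-trans (mismatch≤1 a b) (m≤m+n 1 _)

  runs-insert-≥ : ∀ s c t → runs (s ++ t) ≤ runs (s ++ c ∷ t)
  runs-insert-≥ [] c t = begin
    runs t                    ≤⟨ m≤n+m (runs t) (headMismatch c t) ⟩
    headMismatch c t + runs t ≡⟨ runs-∷ c t ⟨
    runs (c ∷ t)              ∎
    where open ≤-Reasoning
  runs-insert-≥ (a ∷ []) c t = begin
    runs (a ∷ t)                                   ≡⟨ runs-∷ a t ⟩
    headMismatch a t + runs t                      ≤⟨ +-monoˡ-≤ (runs t) (headMismatch-triangle a c t) ⟩
    mismatch a c + headMismatch c t + runs t       ≡⟨ +-assoc (mismatch a c) _ _ ⟩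
    mismatch a c + (headMismatch c t + runs t)     ≡⟨ cong (mismatch a c +_) (runs-∷ c t) ⟨
    mismatch a c + runs (c ∷ t)                    ≡⟨ runs-∷ a (c ∷ t) ⟨
    runs (a ∷ c ∷ t)                               ∎
    where open ≤-Reasoning
  runs-insert-≥ (a ∷ b ∷ s) c t = begin
    runs (a ∷ b ∷ s ++ t)                 ≡⟨ runs-∷ a (b ∷ s ++ t) ⟩
    mismatch a b + runs (b ∷ s ++ t)      ≤⟨ +-monoʳ-≤ (mismatch a b) (runs-insert-≥ (b ∷ s) c t) ⟩
    mismatch a b + runs (b ∷ s ++ c ∷ t)  ≡⟨ runs-∷ a (b ∷ s ++ c ∷ t) ⟨
    runs (a ∷ b ∷ s ++ c ∷ t)             ∎
    where open ≤-Reasoning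

  runs-insert-≤ : ∀ s c t → runs (s ++ c ∷ t) ≤ runs (s ++ t) + 2
  runs-insert-≤ [] c t = begin
    runs (c ∷ t)              ≡⟨ runs-∷ c t ⟩
    headMismatch c t + runs t ≤⟨ +-monoˡ-≤ (runs t) (≤-trans (headMismatch≤1 c t) (n≤1+n 1)) ⟩
    2 + runs t                ≡⟨ +-comm 2 (runs t) ⟩
    runs t + 2                ∎
    where open ≤-Reasoning
  runs-insert-≤ (a ∷ []) c t = begin
    runs (a ∷ c ∷ t)                           ≡⟨ runs-∷ a (c ∷ t) ⟩
    mismatch a c + runs (c ∷ t)                ≡⟨ cong (mismatch a c +_) (runs-∷ c t) ⟩
    mismatch a c + (headMismatch c t + runs t) ≤⟨ +-mono-≤ (mismatch≤1 a c) (+-monoˡ-≤ _ (headMismatch≤1 c t)) ⟩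
    2 + runs t                                 ≤⟨ +-monoʳ-≤ 2 (runs-insert-≥ [] a t) ⟩
    2 + runs (a ∷ t)                           ≡⟨ +-comm 2 (runs (a ∷ t)) ⟩
    runs (a ∷ t) + 2                           ∎
    where open ≤-Reasoning
  runs-insert-≤ (a ∷ b ∷ s) c t = begin
    runs (a ∷ b ∷ s ++ c ∷ t)              ≡⟨ runs-∷ a (b ∷ s ++ c ∷ t) ⟩
    mismatch a b + runs (b ∷ s ++ c ∷ t)   ≤⟨ +-monoʳ-≤ (mismatch a b) (runs-insert-≤ (b ∷ s) c t) ⟩
    mismatch a b + (runs (b ∷ s ++ t) + 2) ≡⟨ +-assoc (mismatch a b) _ 2 ⟨
    mismatch a b + runs (b ∷ s ++ t) + 2   ≡⟨ cong (_+ 2) (runs-∷ a (b ∷ s ++ t)) ⟨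
    runs (a ∷ b ∷ s ++ t) + 2              ∎
    where open ≤-Reasoning

  runs-duplicate : ∀ s c t → runs (s ++ c ∷ c ∷ t) ≡ runs (s ++ c ∷ t)
  runs-duplicate [] c t = begin
    runs (c ∷ c ∷ t)            ≡⟨ runs-∷ c (c ∷ t) ⟩
    mismatch c c + runs (c ∷ t) ≡⟨ cong (_+ runs (c ∷ t)) (mismatch-refl c) ⟩
    runs (c ∷ t)                ∎
    where open ≡-Reasoning
  runs-duplicate (a ∷ s) c t = begin
    runs (a ∷ s ++ c ∷ c ∷ t)                               ≡⟨ runs-∷ a (s ++ c ∷ c ∷ t) ⟩
    headMismatch a (s ++ c ∷ c ∷ t) + runs (s ++ c ∷ c ∷ t) ≡⟨ cong₂ _+_ (same-head s) (runs-duplicate s c t) ⟩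
    headMismatch a (s ++ c ∷ t) + runs (s ++ c ∷ t)         ≡⟨ runs-∷ a (s ++ c ∷ t) ⟨
    runs (a ∷ s ++ c ∷ t)                                   ∎
    where
    open ≡-Reasoning
    same-head : ∀ s → headMismatch a (s ++ c ∷ c ∷ t) ≡ headMismatch a (s ++ c ∷ t)
    same-head []      = refl
    same-head (_ ∷ _) = refl

  -- Sorted rotations and ρ

  lasts : List Str → Str
  lasts = mapMaybe last

  last-nonempty : ∀ {r} → Nonempty r → ∃ λ c → last r ≡ just c
  last-nonempty {[]}        r≢[] = contradiction refl r≢[]
  last-nonempty {x ∷ []}    _    = x , refl
  last-nonempty {x ∷ y ∷ r} _    = last-nonempty {y ∷ r} λ ()

  lasts-∷ : ∀ r {c} Q → last r ≡ just c → lasts (r ∷ Q) ≡ c ∷ lasts Q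
  lasts-∷ r Q last≡ rewrite last≡ = refl

  lasts-middle : ∀ P r {c} Q → last r ≡ just c → lasts (P ++ r ∷ Q) ≡ lasts P ++ c ∷ lasts Q
  lasts-middle P r Q last≡ = trans (mapMaybe-++ last P (r ∷ Q)) (cong (lasts P ++_) (lasts-∷ r Q last≡))

  insert-runs : ∀ {r L} → Nonempty r → Sorted L →
    Σ (List Str) λ L′ → Sorted L′ × L′ ↭ r ∷ L ×
      runs (lasts L) ≤ runs (lasts L′) × runs (lasts L′) ≤ runs (lasts L) + 2
  insert-runs {r} r≢[] L↗ with Linked-insert ≤ω-total r L↗ | last-nonempty r≢[]
  ... | P , Q , refl , L′↗ | c , last≡ = P ++ r ∷ Q , L′↗ , shift r P Q ,
    subst₂ _≤_ without with-r (runs-insert-≥ (lasts P) c (lasts Q)) ,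
    subst₂ (λ m n → m ≤ n + 2) with-r without (runs-insert-≤ (lasts P) c (lasts Q))
    where
    with-r : runs (lasts P ++ c ∷ lasts Q) ≡ runs (lasts (P ++ r ∷ Q))
    with-r = cong runs (sym (lasts-middle P r Q last≡))
    without : runs (lasts P ++ lasts Q) ≡ runs (lasts (P ++ Q))
    without = cong runs (sym (mapMaybe-++ last P Q))

  insert-copy-runs : ∀ {r L} → Nonempty r → r ∈ L → Sorted L →
    Σ (List Str) λ L′ → Sorted L′ × L′ ↭ r ∷ L × runs (lasts L′) ≡ runs (lasts L)
  insert-copy-runs {r} r≢[] r∈L L↗ with ∈-∃++ r∈L | last-nonempty r≢[]
  ... | P , Q , refl | c , last≡ =
    P ++ r ∷ r ∷ Q , Linked-duplicate P (≤ω-reflexive refl) L↗ , shift r P (r ∷ Q) , (begin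
      runs (lasts (P ++ r ∷ r ∷ Q))     ≡⟨ cong runs (lasts-middle P r (r ∷ Q) last≡) ⟩
      runs (lasts P ++ c ∷ lasts (r ∷ Q)) ≡⟨ cong (λ t → runs (lasts P ++ c ∷ t)) (lasts-∷ r Q last≡) ⟩
      runs (lasts P ++ c ∷ c ∷ lasts Q) ≡⟨ runs-duplicate (lasts P) c (lasts Q) ⟩
      runs (lasts P ++ c ∷ lasts Q)     ≡⟨ cong runs (lasts-middle P r Q last≡) ⟨
      runs (lasts (P ++ r ∷ Q))         ∎)
    where open ≡-Reasoning

  insertAll-runs : ∀ Rs {L} → All Nonempty Rs → Sorted L →
    Σ (List Str) λ L′ → Sorted L′ × L′ ↭ Rs ++ L ×
      runs (lasts L) ≤ runs (lasts L′) × runs (lasts L′) ≤ runs (lasts L) + 2 * length Rs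
  insertAll-runs []       _                L↗ = _ , L↗ , ↭-refl , ≤-refl , m≤m+n _ 0
  insertAll-runs (r ∷ Rs) {L} (r≢[] ∷ Rs-nonempty) L↗ with insertAll-runs Rs Rs-nonempty L↗
  ... | L₁ , L₁↗ , L₁↭ , lower₁ , upper₁ with insert-runs r≢[] L₁↗
  ...   | L₂ , L₂↗ , L₂↭ , lower₂ , upper₂ =
    L₂ , L₂↗ , ↭-trans L₂↭ (↭-prep r L₁↭) , ≤-trans lower₁ lower₂ , (begin
      runs (lasts L₂)                      ≤⟨ upper₂ ⟩
      runs (lasts L₁) + 2                  ≤⟨ +-monoˡ-≤ 2 upper₁ ⟩
      runs (lasts L) + 2 * length Rs + 2   ≡⟨ +-assoc (runs (lasts L)) _ 2 ⟩
      runs (lasts L) + (2 * length Rs + 2) ≡⟨ cong (runs (lasts L) +_) (+-comm _ 2) ⟩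
      runs (lasts L) + (2 + 2 * length Rs) ≡⟨ cong (runs (lasts L) +_) (*-suc 2 (length Rs)) ⟨
      runs (lasts L) + 2 * suc (length Rs) ∎)
    where open ≤-Reasoning

  insertCopies-runs : ∀ Rs {L} → All Nonempty Rs → (∀ {r} → r ∈ Rs → r ∈ L) → Sorted L →
    Σ (List Str) λ L′ → Sorted L′ × L′ ↭ Rs ++ L × runs (lasts L′) ≡ runs (lasts L)
  insertCopies-runs []       _                    _    L↗ = _ , L↗ , ↭-refl , refl
  insertCopies-runs (r ∷ Rs) (r≢[] ∷ Rs-nonempty) Rs⊆L L↗
    with insertCopies-runs Rs Rs-nonempty (Rs⊆L ∘ there) L↗
  ... | L₁ , L₁↗ , L₁↭ , same₁
    with insert-copy-runs r≢[] (∈-resp-↭ (↭-sym L₁↭) (∈-++⁺ʳ Rs (Rs⊆L (here refl)))) L₁↗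
  ...   | L₂ , L₂↗ , L₂↭ , same₂ = L₂ , L₂↗ , ↭-trans L₂↭ (↭-prep r L₁↭) , trans same₂ same₁

  rotation-nonempty : ∀ w {i} → i < length w → Nonempty (rotation w i)
  rotation-nonempty w i<|w| rotation≡[] = drop-nonempty w i<|w| (++-conicalˡ _ _ rotation≡[])

  rotations-nonempty : ∀ w → All Nonempty (rotations w)
  rotations-nonempty w = rotationsFrom-nonempty (length w) ≤-refl
    where
    rotationsFrom-nonempty : ∀ k → k ≤ length w → All Nonempty (rotationsFrom w k)
    rotationsFrom-nonempty zero    _       = []
    rotationsFrom-nonempty (suc k) k<|w| = ++⁺ (rotationsFrom-nonempty k (<⇒≤ k<|w|)) (rotation-nonempty w k<|w| ∷ [])

  length-rotations : ∀ w → length (rotations w) ≡ length w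
  length-rotations w = length-rotationsFrom (length w)
    where
    length-rotationsFrom : ∀ k → length (rotationsFrom w k) ≡ k
    length-rotationsFrom zero    = refl
    length-rotationsFrom (suc k) =
      trans (length-++ (rotationsFrom w k)) (trans (cong (_+ 1) (length-rotationsFrom k)) (+-comm k 1))

  allRotations-nonempty : ∀ W → All Nonempty (allRotations W)
  allRotations-nonempty W = concat⁺ (map⁺ (universal rotations-nonempty W))

  rotations⊆allRotations : ∀ {w W r} → w ∈ W → r ∈ rotations w → r ∈ allRotations W
  rotations⊆allRotations w∈W r∈ = ∈-concat⁺′ r∈ (∈-map⁺ rotations w∈W)

  HasRho-unique : ∀ {W k L} → HasRho W k → Sorted L → L ↭ allRotations W → k ≡ runs (lasts L)
  HasRho-unique (_ , (L₀ , L₀↭ , L₀↗ , refl) , refl) L↗ L↭ =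
    cong (runs ∘ lasts) (Sorted-unique (⪯ω-Sorted L₀↗) L↗ (↭-trans L₀↭ (↭-sym L↭)))

  HasRho-exists : ∀ W → ∃ (HasRho W)
  HasRho-exists W with insertAll-runs (allRotations W) {[]} (allRotations-nonempty W) []
  ... | L , L↗ , L↭W++[] , _ = runs (lasts L) , lasts L , (L , L↭W , Sorted-⪯ω L-nonempty L↗ , refl) , refl
    where
    L↭W : L ↭ allRotations W
    L↭W = subst (L ↭_) (++-identityʳ _) L↭W++[]
    L-nonempty : All Nonempty L
    L-nonempty = All-resp-↭ (↭-sym L↭W) (allRotations-nonempty W)

  HasRho-↭ : ∀ {W W′ k} → W ↭ W′ → HasRho W k → HasRho W′ k
  HasRho-↭ W↭W′ (s , (L , L↭ , L⪯ , s≡) , runs≡) =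
    s , (L , ↭-trans L↭ (concatMap-↭ rotations W↭W′) , L⪯ , s≡) , runs≡

  HasRho-∷-bounds : ∀ w W {k k′} → HasRho W k → HasRho (w ∷ W) k′ → k ≤ k′ × k′ ≤ k + 2 * length w
  HasRho-∷-bounds w W (_ , (L , L↭ , L⪯ , refl) , refl) ρ′
    with insertAll-runs (rotations w) (rotations-nonempty w) (⪯ω-Sorted L⪯)
  ... | L′ , L′↗ , L′↭ , lower , upper
    with HasRho-unique {w ∷ W} ρ′ L′↗ (↭-trans L′↭ (++⁺ˡ (rotations w) L↭))
  ...   | refl = lower , subst (λ n → runs (lasts L′) ≤ runs (lasts L) + 2 * n) (length-rotations w) upper

  HasRho-∷-present : ∀ {w W k k′} → w ∈ W → HasRho W k → HasRho (w ∷ W) k′ → k′ ≡ k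
  HasRho-∷-present {w} {W} w∈W (_ , (L , L↭ , L⪯ , refl) , refl) ρ′
    with insertCopies-runs (rotations w) (rotations-nonempty w) rotations⊆L (⪯ω-Sorted L⪯)
    where
    rotations⊆L : ∀ {r} → r ∈ rotations w → r ∈ L
    rotations⊆L = ∈-resp-↭ (↭-sym L↭) ∘ rotations⊆allRotations w∈W
  ... | L′ , L′↗ , L′↭ , same = trans (HasRho-unique {w ∷ W} ρ′ L′↗ (↭-trans L′↭ (++⁺ˡ (rotations w) L↭))) same

  count≡length-filter : ∀ w W → count w W ≡ length (filter (w ≟*_) W)
  count≡length-filter w []      = refl
  count≡length-filter w (u ∷ W) with w ≟* u
  ... | yes _ = cong suc (count≡length-filter w W)
  ... | no  _ = count≡length-filter w W

  count-↭ : ∀ w {W W′} → W ↭ W′ → count w W ≡ count w W′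
  count-↭ w {W} {W′} W↭W′ = begin
    count w W                              ≡⟨ count≡length-filter w W ⟩
    length (filter (w ≟*_) W)       ≡⟨ ↭-length (filter-↭ (w ≟*_) W↭W′) ⟩
    length (filter (w ≟*_) W′)      ≡⟨ count≡length-filter w W′ ⟨
    count w W′                             ∎
    where open ≡-Reasoning

  count-∷-self : ∀ w W → count w (w ∷ W) ≡ suc (count w W)
  count-∷-self w W with w ≟* w
  ... | yes _   = refl
  ... | no  w≢w = contradiction refl w≢w

  count>0⇒∈ : ∀ {w W} → 0 < count w W → w ∈ W
  count>0⇒∈ {w} {u ∷ W} 0<count with w ≟* u
  ... | yes w≡u = here w≡u
  ... | no  _   = there (count>0⇒∈ 0<count)

proposition3 : (Sym : Set) (_≺_ : Sym → Sym → Set) (sto : IsStrictTotalOrder _≡_ _≺_) →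
  let open Alphabet Sym _≺_ sto in
  (A : List Str) → All Nonempty A →
  (w : Str) → 1 ≤ count w A →
  (B : List Str) → A ↭ (w ∷ B) →
    (Σ ℕ λ k → HasRho A k) × (Σ ℕ λ k → HasRho B k) ×
    (∀ kA kB → HasRho A kA → HasRho B kB →
      (2 ≤ count w A → kA ≡ kB) ×
      (count w A ≡ 1 → (kB ≤ kA) × (kA ≤ kB + 2 * length w)))
proposition3 Sym _≺_ sto A _ w _ B A↭w∷B =
  HasRho-exists A , HasRho-exists B , λ kA kB ρA ρB →
    (λ 2≤m → HasRho-∷-present (w∈B 2≤m) ρB (HasRho-↭ A↭w∷B ρA)) ,
    (λ _ → HasRho-∷-bounds w B ρB (HasRho-↭ A↭w∷B ρA))
  where
  open Alphabet Sym _≺_ sto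
  open EBWT Sym _≺_ sto
  w∈B : 2 ≤ count w A → w ∈ B
  w∈B 2≤m = count>0⇒∈ (s≤s⁻¹ (subst (2 ≤_) (trans (count-↭ w A↭w∷B) (count-∷-self w B)) 2≤m))
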